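{- For every $n\ge 2$, in the polynomial ring $\mathbb{Z}[p,q]$, \[\sum_{\pi\in\mathcal{DU}_n^*} q^{\pi_1}p^{\pi_2-\pi_1}=\sum_{\pi\in\mathcal{DU}_n^*} p^{\pi_1}q^{\pi_2-\pi_1}.\]
   Context: $[n]=\{1,\dots,n\}$. For a permutation $\pi$ of $[n]$, its complement $\overline{\pi}$ is given by $\overline{\pi}_i=n+1-\pi_i$. $\mathcal{DU}_n$ is the set of permutations of $[n]$ with $\pi_1>\pi_2<\pi_3>\cdots$, and $\mathcal{DU}_n^*$ is the set of permutations $\pi$ of $[n]$ with $\overline{\pi}\in\mathcal{DU}_n$ (i.e. $\pi_1<\pi_2>\pi_3<\cdots$). -}

module Defs where

open import Data.Nat using (ℕ; zero; suc; _+_; _∸_; _<ᵇ_; _≡ᵇ_)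
open import Data.Integer using (ℤ; +_)
import Data.Integer as ℤ
open import Data.Bool using (Bool; true; false; _∧_; if_then_else_)
open import Relation.Binary.PropositionalEquality using (_≡_)
open import Data.List using (List; []; _∷_; [_]; map; concatMap; filterᵇ; upTo; length)

-- Permutations of [n] in one-line notation π = π₁ π₂ … πₙ (as lists).

insertions : ℕ → List ℕ → List (List ℕ)
insertions x [] = [ x ∷ [] ]
insertions x (y ∷ ys) = (x ∷ y ∷ ys) ∷ map (y ∷_) (insertions x ys)

arrangements : List ℕ → List (List ℕ)
arrangements [] = [ [] ]
arrangements (x ∷ xs) = concatMap (insertions x) (arrangements xs)

range : ℕ → List ℕ
range n = map suc (upTo n)

Perms : ℕ → List (List ℕ)
Perms n = arrangements (range n)

complement : ℕ → List ℕ → List ℕ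
complement n π = map (λ x → suc n ∸ x) π

isDown isUp : List ℕ → Bool
isDown (x ∷ y ∷ rest) = (y <ᵇ x) ∧ isUp (y ∷ rest)
isDown _ = true
isUp (x ∷ y ∷ rest) = (x <ᵇ y) ∧ isDown (y ∷ rest)
isUp _ = true

isDU : List ℕ → Bool
isDU = isDown

DU* : ℕ → List (List ℕ)
DU* n = filterᵇ (λ π → isDU (complement n π)) (Perms n)

-- Polynomials in ℤ[p,q], represented by their coefficient function:
-- P i j = coefficient of p^i q^j.  Equality of polynomials is pointwise
-- equality of coefficients.
Poly : Set
Poly = ℕ → ℕ → ℤ

0P : Poly
0P _ _ = + 0

_+P_ : Poly → Poly → Poly
(P +P Q) i j = P i j ℤ.+ Q i j

mono : ℕ → ℕ → Poly
mono a b i j = if (i ≡ᵇ a) ∧ (j ≡ᵇ b) then + 1 else + 0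

ΣP : {A : Set} → List A → (A → Poly) → Poly
ΣP [] f = 0P
ΣP (x ∷ xs) f = f x +P ΣP xs f

_≈P_ : Poly → Poly → Set
P ≈P Q = ∀ i j → P i j ≡ Q i j

-- q^{π₁} p^{π₂-π₁}  (only used for n ≥ 2, where π has ≥ 2 entries)
termL : List ℕ → Poly
termL (a ∷ b ∷ _) = mono (b ∸ a) a
termL _ = 0P

termR : List ℕ → Poly
termR (a ∷ b ∷ _) = mono a (b ∸ a)
termR _ = 0P

-- Write π ∈ DU*ₙ as a m r with a < m and put b = m − a. The relabelling slide a b,
-- sending a to b and keeping the relative order of all other values, fixes m (as
-- a, b < m), so φ π = b m (slide a b r) is again in DU*ₙ; since m − b = a, φ is an
-- involution of DU*ₙ, and it turns q^{π₁} p^{π₂−π₁} into p^{π₁} q^{π₂−π₁}.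
module Submission where

open import Defs
open import Data.Nat using (ℕ; zero; suc; pred; _∸_; _≤_; _<_; _<ᵇ_; z≤n; s≤s; z<s; s<s; _≟_)
open import Data.Nat.Properties
  using (suc-injective; <⇒<ᵇ; <ᵇ⇒<; <-cmp; <-asym; <-irrefl; <⇒≤; ≤-trans; m≤n⇒m≤1+n; ∸-monoʳ-<; m<n⇒0<n∸m; m∸[m∸n]≡n; m∸n≤m)
open import Data.Integer using (ℤ; +_)
import Data.Integer as ℤ
open import Data.Integer.Properties using (+-0-isCommutativeMonoid)
open import Data.Bool using (Bool; true; false; T; _∧_)
open import Data.Bool.Properties using (T?; T-∧)
open import Data.Empty using (⊥-elim)
open import Data.Product using (_×_; _,_; proj₁; proj₂)
open import Data.List using (List; []; _∷_; _++_; map; foldr; concatMap; filter)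
open import Data.List.Properties using (∷-injectiveˡ; ∷-injectiveʳ; map-∘; map-cong; map-id; filter-all; filter-accept; filter-reject)
open import Data.List.Relation.Unary.All as All using (All; []; _∷_)
import Data.List.Relation.Unary.All.Properties as All
open import Data.List.Relation.Unary.Any using (here; there)
open import Data.List.Relation.Unary.AllPairs using ([]; _∷_)
open import Data.List.Relation.Unary.Unique.Propositional using (Unique)
import Data.List.Relation.Unary.Unique.Propositional.Properties as Unique
open import Data.List.Membership.Propositional using (_∈_; find; lose)
open import Data.List.Membership.Propositional.Properties
  using (∈-map⁺; ∈-map⁻; ∈-concatMap⁺; ∈-concatMap⁻; ∈-∃++; ∈-upTo⁺; ∈-upTo⁻; ∈-filter⁺; ∈-filter⁻)
open import Data.List.Membership.Propositional.Properties.WithK using (unique∧set⇒bag)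
open import Data.List.Relation.Binary.BagAndSetEquality using (∼bag⇒↭)
open import Data.List.Relation.Binary.Permutation.Propositional
  using (_↭_; ↭-refl; ↭-prep; ↭-swap; ↭-trans; ↭-sym; ↭⇒↭ₛ′)
open import Data.List.Relation.Binary.Permutation.Propositional.Properties
  using (map⁺; drop-mid; All-resp-↭; ∈-resp-↭; ↭-empty-inv)
import Data.List.Relation.Binary.Permutation.Setoid.Properties as Permutationₛ
open import Function using (_∘_; Equivalence; mk⇔)
open import Relation.Nullary using (¬_; yes; no)
open import Relation.Nullary.Decidable using (¬?)
open import Relation.Binary.Definitions using (tri<; tri≈; tri>)
open import Relation.Binary.PropositionalEquality
  using (_≡_; _≢_; refl; sym; trans; cong; cong₂; subst; subst₂; setoid; isEquivalence; module ≡-Reasoning)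

private
  variable
    A B : Set
    L M : List A
    a m n x y : ℕ
    π r xs ys zs : List ℕ

coefficient-ΣP : (L : List A) (f : A → Poly) (i j : ℕ) →
                 ΣP L f i j ≡ foldr ℤ._+_ (+ 0) (map (λ x → f x i j) L)
coefficient-ΣP [] f i j = refl
coefficient-ΣP (x ∷ L) f i j = cong (ℤ._+_ (f x i j)) (coefficient-ΣP L f i j)

sumℤ-↭ : {ks ls : List ℤ} → ks ↭ ls → foldr ℤ._+_ (+ 0) ks ≡ foldr ℤ._+_ (+ 0) ls
sumℤ-↭ = Permutationₛ.foldr-commMonoid (setoid ℤ) +-0-isCommutativeMonoid ∘ ↭⇒↭ₛ′ isEquivalence

ΣP-↭ : (f : A → Poly) → L ↭ M → ΣP L f ≈P ΣP M f
ΣP-↭ {L = L} {M = M} f L↭M i j = begin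
  ΣP L f i j                                 ≡⟨ coefficient-ΣP L f i j ⟩
  foldr ℤ._+_ (+ 0) (map (λ x → f x i j) L)  ≡⟨ sumℤ-↭ (map⁺ _ L↭M) ⟩
  foldr ℤ._+_ (+ 0) (map (λ x → f x i j) M)  ≡⟨ coefficient-ΣP M f i j ⟨
  ΣP M f i j                                 ∎
  where open ≡-Reasoning

ΣP-map : (g : A → B) (f : B → Poly) (L : List A) → ΣP (map g L) f ≈P ΣP L (f ∘ g)
ΣP-map g f [] i j = refl
ΣP-map g f (x ∷ L) i j = cong (ℤ._+_ (f (g x) i j)) (ΣP-map g f L i j)

ΣP-cong : {f g : A → Poly} → (∀ {x} → x ∈ L → f x ≈P g x) → ΣP L f ≈P ΣP L g
ΣP-cong {L = []} f≈g i j = refl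
ΣP-cong {L = x ∷ L} f≈g i j = cong₂ ℤ._+_ (f≈g (here refl) i j) (ΣP-cong (f≈g ∘ there) i j)

Unique-resp-↭ : {A : Set} {L M : List A} → L ↭ M → Unique L → Unique M
Unique-resp-↭ {A} = Permutationₛ.Unique-resp-↭ (setoid A) ∘ ↭⇒↭ₛ′ isEquivalence

unique⇒↭ : Unique L → Unique M → (∀ {x} → x ∈ L → x ∈ M) → (∀ {x} → x ∈ M → x ∈ L) → L ↭ M
unique⇒↭ uL uM L⊆M M⊆L = ∼bag⇒↭ (unique∧set⇒bag uL uM (mk⇔ L⊆M M⊆L))

map⁺-injectiveOn : (f : A → B) → (∀ {x y} → x ∈ L → y ∈ L → f x ≡ f y → x ≡ y) →
                   Unique L → Unique (map f L)
map⁺-injectiveOn f inj [] = []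
map⁺-injectiveOn f inj (x∉L ∷ u) =
  All.map⁺ (All.tabulate λ y∈L fx≡fy → All.lookup x∉L y∈L (inj (here refl) (there y∈L) fx≡fy))
  ∷ map⁺-injectiveOn f (λ x∈ y∈ → inj (there x∈) (there y∈)) u

map-bijectionOn-↭ : (f g : A → A) → Unique L →
                    (∀ {x} → x ∈ L → f x ∈ L) → (∀ {x} → x ∈ L → g x ∈ L) →
                    (∀ {x} → x ∈ L → g (f x) ≡ x) → (∀ {x} → x ∈ L → f (g x) ≡ x) →
                    map f L ↭ L
map-bijectionOn-↭ {L = L} f g u f∈ g∈ gf≡ fg≡ =
  unique⇒↭ (map⁺-injectiveOn f injective u) u image⊆ ⊆image
  where
  injective : ∀ {x y} → x ∈ L → y ∈ L → f x ≡ f y → x ≡ y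
  injective x∈ y∈ fx≡fy = trans (sym (gf≡ x∈)) (trans (cong g fx≡fy) (gf≡ y∈))
  image⊆ : ∀ {y} → y ∈ map f L → y ∈ L
  image⊆ y∈ with x , x∈ , refl ← ∈-map⁻ f y∈ = f∈ x∈
  ⊆image : ∀ {y} → y ∈ L → y ∈ map f L
  ⊆image y∈ = subst (_∈ map f L) (fg≡ y∈) (∈-map⁺ f (g∈ y∈))

∈-insertions⁻ : zs ∈ insertions x ys → zs ↭ x ∷ ys
∈-insertions⁻ {ys = []} (here refl) = ↭-refl
∈-insertions⁻ {ys = y ∷ ys} (here refl) = ↭-refl
∈-insertions⁻ {x = x} {ys = y ∷ ys} (there zs∈) with ws , ws∈ , refl ← ∈-map⁻ (y ∷_) zs∈ =
  ↭-trans (↭-prep y (∈-insertions⁻ ws∈)) (↭-swap y x ↭-refl)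

∈-insertions⁺ : ∀ x us vs → us ++ x ∷ vs ∈ insertions x (us ++ vs)
∈-insertions⁺ x [] [] = here refl
∈-insertions⁺ x [] (v ∷ vs) = here refl
∈-insertions⁺ x (u ∷ us) vs = there (∈-map⁺ (u ∷_) (∈-insertions⁺ x us vs))

∈-arrangements⁻ : ∀ xs → zs ∈ arrangements xs → zs ↭ xs
∈-arrangements⁻ [] (here refl) = ↭-refl
∈-arrangements⁻ (x ∷ xs) zs∈ with ys , ys∈ , zs∈′ ← find (∈-concatMap⁻ (insertions x) {arrangements xs} zs∈) =
  ↭-trans (∈-insertions⁻ zs∈′) (↭-prep x (∈-arrangements⁻ xs ys∈))

∈-arrangements⁺ : ∀ xs → zs ↭ xs → zs ∈ arrangements xs
∈-arrangements⁺ [] zs↭[] rewrite ↭-empty-inv zs↭[] = here refl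
∈-arrangements⁺ (x ∷ xs) zs↭ with us , vs , refl ← ∈-∃++ (∈-resp-↭ (↭-sym zs↭) (here refl)) =
  ∈-concatMap⁺ (insertions x) (lose (∈-arrangements⁺ xs (drop-mid us [] zs↭)) (∈-insertions⁺ x us vs))

filter-insertions : All (x ≢_) ys → zs ∈ insertions x ys → filter (¬? ∘ (x ≟_)) zs ≡ ys
filter-insertions {x} {[]} _ (here refl) = filter-reject (¬? ∘ (x ≟_)) (λ x≢x → x≢x refl)
filter-insertions {x} {y ∷ ys} x∉ (here refl) =
  trans (filter-reject (¬? ∘ (x ≟_)) (λ x≢x → x≢x refl)) (filter-all (¬? ∘ (x ≟_)) x∉)
filter-insertions {x} {y ∷ ys} (x≢y ∷ x∉) (there zs∈) with ws , ws∈ , refl ← ∈-map⁻ (y ∷_) zs∈ =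
  trans (filter-accept (¬? ∘ (x ≟_)) x≢y) (cong (y ∷_) (filter-insertions x∉ ws∈))

insertions-unique : All (x ≢_) ys → Unique (insertions x ys)
insertions-unique {ys = []} _ = [] ∷ []
insertions-unique {ys = y ∷ ys} (x≢y ∷ x∉) =
  All.map⁺ (All.tabulate λ _ eq → x≢y (∷-injectiveˡ eq)) ∷ Unique.map⁺ ∷-injectiveʳ (insertions-unique x∉)

concatMap-insertions-unique : {L : List (List ℕ)} → Unique L → (∀ {ys} → ys ∈ L → All (x ≢_) ys) →
                              Unique (concatMap (insertions x) L)
concatMap-insertions-unique {L = []} [] _ = []
concatMap-insertions-unique {x = x} {L = ys ∷ L} (ys∉L ∷ u) x∉ =
  Unique.++⁺ (insertions-unique (x∉ (here refl))) (concatMap-insertions-unique u (x∉ ∘ there)) disjoint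
  where
  disjoint : ∀ {zs} → ¬ (zs ∈ insertions x ys × zs ∈ concatMap (insertions x) L)
  disjoint (zs∈ , zs∈L) with ys′ , ys′∈L , zs∈′ ← find (∈-concatMap⁻ (insertions x) {L} zs∈L) =
    All.lookup ys∉L ys′∈L (trans (sym (filter-insertions (x∉ (here refl)) zs∈))
                                 (filter-insertions (x∉ (there ys′∈L)) zs∈′))

arrangements-unique : Unique xs → Unique (arrangements xs)
arrangements-unique {[]} [] = [] ∷ []
arrangements-unique {x ∷ xs} (x∉ ∷ u) =
  concatMap-insertions-unique (arrangements-unique u)
    (λ ys∈ → All-resp-↭ (↭-sym (∈-arrangements⁻ xs ys∈)) x∉)

InRange : ℕ → ℕ → Set
InRange n x = 0 < x × x ≤ n

∈-range⁻ : ∀ n → x ∈ range n → InRange n x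
∈-range⁻ n x∈ with i , i∈ , refl ← ∈-map⁻ suc x∈ = z<s , ∈-upTo⁻ i∈

∈-range⁺ : ∀ n → InRange n x → x ∈ range n
∈-range⁺ {suc x} n (_ , x<n) = ∈-map⁺ suc (∈-upTo⁺ x<n)

range-unique : ∀ n → Unique (range n)
range-unique n = Unique.map⁺ suc-injective (Unique.upTo⁺ n)

-- Alternation is invariant under order-preserving relabelling

T-injective : {b c : Bool} → (T b → T c) → (T c → T b) → b ≡ c
T-injective {false} {false} _ _ = refl
T-injective {false} {true} _ c⇒b = ⊥-elim (c⇒b _)
T-injective {true} {false} b⇒c _ = ⊥-elim (b⇒c _)
T-injective {true} {true} _ _ = refl

<ᵇ-cong : ∀ {x y u v} → (x < y → u < v) → (u < v → x < y) → (x <ᵇ y) ≡ (u <ᵇ v)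
<ᵇ-cong {x} {y} {u} {v} to from = T-injective (<⇒<ᵇ ∘ to ∘ <ᵇ⇒< x y) (<⇒<ᵇ ∘ from ∘ <ᵇ⇒< u v)

StrictlyMonotoneOn StrictlyAntitoneOn : (ℕ → Set) → (ℕ → ℕ) → Set
StrictlyMonotoneOn P f = ∀ {x y} → P x → P y → x < y → f x < f y
StrictlyAntitoneOn P f = ∀ {x y} → P x → P y → x < y → f y < f x

module _ {P : ℕ → Set} {f : ℕ → ℕ} where

  <ᵇ-monotoneOn : StrictlyMonotoneOn P f → P x → P y → (f x <ᵇ f y) ≡ (x <ᵇ y)
  <ᵇ-monotoneOn {x} {y} mono px py = sym (<ᵇ-cong (mono px py) reflect)
    where
    reflect : f x < f y → x < y
    reflect fx<fy with <-cmp x y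
    ... | tri< x<y _ _ = x<y
    ... | tri≈ _ refl _ = ⊥-elim (<-asym fx<fy fx<fy)
    ... | tri> _ _ y<x = ⊥-elim (<-asym fx<fy (mono py px y<x))

  <ᵇ-antitoneOn : StrictlyAntitoneOn P f → P x → P y → (f y <ᵇ f x) ≡ (x <ᵇ y)
  <ᵇ-antitoneOn {x} {y} anti px py = sym (<ᵇ-cong (anti px py) reflect)
    where
    reflect : f y < f x → x < y
    reflect fy<fx with <-cmp x y
    ... | tri< x<y _ _ = x<y
    ... | tri≈ _ refl _ = ⊥-elim (<-asym fy<fx fy<fx)
    ... | tri> _ _ y<x = ⊥-elim (<-asym fy<fx (anti py px y<x))

  map-preserves-alternation : StrictlyMonotoneOn P f → All P π →
                              isDown (map f π) ≡ isDown π × isUp (map f π) ≡ isUp π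
  map-preserves-alternation mono [] = refl , refl
  map-preserves-alternation mono (_ ∷ []) = refl , refl
  map-preserves-alternation mono (px ∷ py ∷ ps) with down , up ← map-preserves-alternation mono (py ∷ ps) =
    cong₂ _∧_ (<ᵇ-monotoneOn mono py px) up , cong₂ _∧_ (<ᵇ-monotoneOn mono px py) down

  map-reverses-alternation : StrictlyAntitoneOn P f → All P π →
                             isDown (map f π) ≡ isUp π × isUp (map f π) ≡ isDown π
  map-reverses-alternation anti [] = refl , refl
  map-reverses-alternation anti (_ ∷ []) = refl , refl
  map-reverses-alternation anti (px ∷ py ∷ ps) with down , up ← map-reverses-alternation anti (py ∷ ps) =
    cong₂ _∧_ (<ᵇ-antitoneOn anti px py) up , cong₂ _∧_ (<ᵇ-antitoneOn anti py px) down

-- Moving one value while keeping the relative order of the others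

-- As for Data.Fin: punchIn b skips the value b, punchOut a closes the gap at a
-- (punchOut a a is junk).
punchIn : ℕ → ℕ → ℕ
punchIn zero y = suc y
punchIn (suc b) zero = zero
punchIn (suc b) (suc y) = suc (punchIn b y)

punchOut : ℕ → ℕ → ℕ
punchOut zero x = pred x
punchOut (suc a) zero = zero
punchOut (suc a) (suc x) = suc (punchOut a x)

punchIn-≢ : ∀ b y → punchIn b y ≢ b
punchIn-≢ (suc b) (suc y) eq = punchIn-≢ b y (suc-injective eq)

punchOut-punchIn : ∀ b y → punchOut b (punchIn b y) ≡ y
punchOut-punchIn zero y = refl
punchOut-punchIn (suc b) zero = refl
punchOut-punchIn (suc b) (suc y) = cong suc (punchOut-punchIn b y)

punchIn-punchOut : ∀ a x → x ≢ a → punchIn a (punchOut a x) ≡ x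
punchIn-punchOut zero zero x≢a = ⊥-elim (x≢a refl)
punchIn-punchOut zero (suc x) x≢a = refl
punchIn-punchOut (suc a) zero x≢a = refl
punchIn-punchOut (suc a) (suc x) x≢a = cong suc (punchIn-punchOut a x (x≢a ∘ cong suc))

punchIn-mono-< : ∀ b → x < y → punchIn b x < punchIn b y
punchIn-mono-< zero x<y = s<s x<y
punchIn-mono-< {zero} {suc y} (suc b) x<y = z<s
punchIn-mono-< {suc x} {suc y} (suc b) (s<s x<y) = s<s (punchIn-mono-< b x<y)

punchOut-mono-< : ∀ a → x ≢ a → y ≢ a → x < y → punchOut a x < punchOut a y
punchOut-mono-< {zero} zero x≢a _ _ = ⊥-elim (x≢a refl)
punchOut-mono-< {suc x} {suc y} zero _ _ (s<s x<y) = x<y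
punchOut-mono-< {zero} {suc y} (suc a) _ _ _ = z<s
punchOut-mono-< {suc x} {suc y} (suc a) x≢a y≢a (s<s x<y) =
  s<s (punchOut-mono-< a (x≢a ∘ cong suc) (y≢a ∘ cong suc) x<y)

punchIn-≥ : ∀ b → b ≤ y → punchIn b y ≡ suc y
punchIn-≥ zero _ = refl
punchIn-≥ (suc b) (s≤s b≤y) = cong suc (punchIn-≥ b b≤y)

punchOut-suc : ∀ a → a ≤ y → punchOut a (suc y) ≡ y
punchOut-suc zero _ = refl
punchOut-suc (suc a) (s≤s a≤y) = cong suc (punchOut-suc a a≤y)

punchIn-≤ : ∀ b → b ≤ n → y < n → punchIn b y ≤ n
punchIn-≤ zero _ y<n = y<n
punchIn-≤ {y = zero} (suc b) _ _ = z≤n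
punchIn-≤ {y = suc y} (suc b) (s≤s b≤n) (s<s y<n) = s≤s (punchIn-≤ b b≤n y<n)

punchOut-< : ∀ a → a ≤ n → x ≤ n → x ≢ a → punchOut a x < n
punchOut-< {x = zero} zero _ _ x≢a = ⊥-elim (x≢a refl)
punchOut-< {x = suc x} zero _ x<n _ = x<n
punchOut-< {x = zero} (suc a) (s≤s _) _ _ = z<s
punchOut-< {x = suc x} (suc a) (s≤s a≤n) (s≤s x≤n) x≢a = s<s (punchOut-< a a≤n x≤n (x≢a ∘ cong suc))

slide : ℕ → ℕ → ℕ → ℕ
slide a b x with x ≟ a
... | yes _ = b
... | no _ = punchIn b (punchOut a x)

slide-source : ∀ a b → slide a b a ≡ b
slide-source a b with a ≟ a
... | yes _ = refl
... | no a≢a = ⊥-elim (a≢a refl)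

slide-≢ : ∀ a b → x ≢ a → slide a b x ≡ punchIn b (punchOut a x)
slide-≢ {x} a b x≢a with x ≟ a
... | yes x≡a = ⊥-elim (x≢a x≡a)
... | no _ = refl

slide-fixes-above : ∀ a b → a < m → b < m → slide a b m ≡ m
slide-fixes-above {suc m} a b (s≤s a≤m) (s≤s b≤m) = begin
  slide a b (suc m)              ≡⟨ slide-≢ a b (λ { refl → <-irrefl refl a≤m }) ⟩
  punchIn b (punchOut a (suc m)) ≡⟨ cong (punchIn b) (punchOut-suc a a≤m) ⟩
  punchIn b m                    ≡⟨ punchIn-≥ b b≤m ⟩
  suc m                          ∎
  where open ≡-Reasoning

slide-inverse : ∀ a b x → slide b a (slide a b x) ≡ x
slide-inverse a b x with x ≟ a
... | yes refl = slide-source b a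
... | no x≢a = begin
  slide b a (punchIn b (punchOut a x))              ≡⟨ slide-≢ b a (punchIn-≢ b (punchOut a x)) ⟩
  punchIn a (punchOut b (punchIn b (punchOut a x))) ≡⟨ cong (punchIn a) (punchOut-punchIn b (punchOut a x)) ⟩
  punchIn a (punchOut a x)                          ≡⟨ punchIn-punchOut a x x≢a ⟩
  x                                                 ∎
  where open ≡-Reasoning

slide-monotone : ∀ a b → StrictlyMonotoneOn (a ≢_) (slide a b)
slide-monotone a b {x} {y} a≢x a≢y x<y
  rewrite slide-≢ a b (a≢x ∘ sym) | slide-≢ a b (a≢y ∘ sym) =
  punchIn-mono-< b (punchOut-mono-< a (a≢x ∘ sym) (a≢y ∘ sym) x<y)

slide-inRange : ∀ {n a b x} → InRange n a → InRange n b → InRange n x → InRange n (slide a b x)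
slide-inRange {n} {a} {b} {x} (0<a , a≤n) (0<b , b≤n) (0<x , x≤n) with x ≟ a
... | yes _ = 0<b , b≤n
... | no x≢a = punchIn-positive b (punchOut-positive a x 0<a 0<x) , punchIn-≤ b b≤n (punchOut-< a a≤n x≤n x≢a)
  where
  punchOut-positive : ∀ a x → 0 < a → 0 < x → 0 < punchOut a x
  punchOut-positive (suc a) (suc x) _ _ = z<s
  punchIn-positive : ∀ b {y} → 0 < y → 0 < punchIn b y
  punchIn-positive zero _ = z<s
  punchIn-positive (suc b) {suc y} _ = z<s

map-slide-range : ∀ {n a b} → InRange n a → InRange n b → map (slide a b) (range n) ↭ range n
map-slide-range {n} {a} {b} a∈ b∈ =
  map-bijectionOn-↭ (slide a b) (slide b a) (range-unique n)
    (closed a∈ b∈) (closed b∈ a∈) (λ {x} _ → slide-inverse a b x) (λ {x} _ → slide-inverse b a x)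
  where
  closed : ∀ {c d} → InRange n c → InRange n d → ∀ {x} → x ∈ range n → slide c d x ∈ range n
  closed c∈ d∈ x∈ = ∈-range⁺ n (slide-inRange c∈ d∈ (∈-range⁻ n x∈))

isDU-complement : π ↭ range n → isDU (complement n π) ≡ isUp π
isDU-complement {n = n} π↭ =
  proj₁ (map-reverses-alternation {f = suc n ∸_} (λ _ y≤ x<y → ∸-monoʳ-< x<y y≤) bounded)
  where
  bounded : All (_≤ suc n) _
  bounded = All.tabulate λ x∈ → m≤n⇒m≤1+n (proj₂ (∈-range⁻ n (∈-resp-↭ π↭ x∈)))

isDU* : ℕ → List ℕ → Bool
isDU* n π = isDU (complement n π)

∈-DU*⁻ : ∀ n → π ∈ DU* n → π ↭ range n × T (isUp π)
∈-DU*⁻ n π∈ with π∈Perms , du ← ∈-filter⁻ (T? ∘ isDU* n) {xs = Perms n} π∈ =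
  π↭ , subst T (isDU-complement π↭) du
  where
  π↭ : _ ↭ range n
  π↭ = ∈-arrangements⁻ (range n) π∈Perms

∈-DU*⁺ : ∀ n → π ↭ range n → T (isUp π) → π ∈ DU* n
∈-DU*⁺ n π↭ up =
  ∈-filter⁺ (T? ∘ isDU* n) {xs = Perms n} (∈-arrangements⁺ (range n) π↭) (subst T (sym (isDU-complement π↭)) up)

DU*-unique : ∀ n → Unique (DU* n)
DU*-unique n = Unique.filter⁺ (T? ∘ isDU* n) (arrangements-unique (range-unique n))

DU*-head : ∀ n → a ∷ m ∷ r ∈ DU* n → InRange n a × a < m × m ≤ n
DU*-head {a} {m} n π∈ with π↭ , up ← ∈-DU*⁻ n π∈ =
  ∈-range⁻ n (∈-resp-↭ π↭ (here refl)) ,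
  <ᵇ⇒< a m (proj₁ (Equivalence.to T-∧ up)) ,
  proj₂ (∈-range⁻ n (∈-resp-↭ π↭ (there (here refl))))

-- The involution

φ : List ℕ → List ℕ
φ (a ∷ m ∷ r) = map (slide a (m ∸ a)) (a ∷ m ∷ r)
φ π = π

m∸n<m : 0 < a → a < m → m ∸ a < m
m∸n<m 0<a a<m = ∸-monoʳ-< 0<a (<⇒≤ a<m)

slide-fixes-second : 0 < a → a < m → slide a (m ∸ a) m ≡ m
slide-fixes-second {a} 0<a a<m = slide-fixes-above a _ a<m (m∸n<m 0<a a<m)

φ-∷ : 0 < a → a < m → φ (a ∷ m ∷ r) ≡ m ∸ a ∷ m ∷ map (slide a (m ∸ a)) r
φ-∷ {a = a} {m = m} {r = r} 0<a a<m =
  cong₂ (λ u v → u ∷ v ∷ map (slide a (m ∸ a)) r) (slide-source a (m ∸ a)) (slide-fixes-second 0<a a<m)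

φ-involutive-∷ : 0 < a → a < m → φ (φ (a ∷ m ∷ r)) ≡ a ∷ m ∷ r
φ-involutive-∷ {a = a} {m = m} {r = r} 0<a a<m = begin
  φ (φ (a ∷ m ∷ r))                   ≡⟨ cong φ (φ-∷ 0<a a<m) ⟩
  φ (b ∷ m ∷ r′)                      ≡⟨ φ-∷ (m<n⇒0<n∸m a<m) (m∸n<m 0<a a<m) ⟩
  m ∸ b ∷ m ∷ map (slide b (m ∸ b)) r′ ≡⟨ cong (λ c → c ∷ m ∷ map (slide b c) r′) (m∸[m∸n]≡n (<⇒≤ a<m)) ⟩
  a ∷ m ∷ map (slide b a) r′          ≡⟨ cong (λ t → a ∷ m ∷ t) map-slide-inverse ⟩
  a ∷ m ∷ r                           ∎
  where
  open ≡-Reasoning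
  b : ℕ
  b = m ∸ a
  r′ : List ℕ
  r′ = map (slide a b) r
  map-slide-inverse : map (slide b a) r′ ≡ r
  map-slide-inverse = trans (sym (map-∘ r)) (trans (map-cong (slide-inverse a b) r) (map-id r))

termL∘φ-∷ : 0 < a → a < m → termL (φ (a ∷ m ∷ r)) ≈P termR (a ∷ m ∷ r)
termL∘φ-∷ {a = a} {m = m} {r = r} 0<a a<m i j = begin
  termL (φ (a ∷ m ∷ r)) i j       ≡⟨ cong (λ π → termL π i j) (φ-∷ {r = r} 0<a a<m) ⟩
  mono (m ∸ (m ∸ a)) (m ∸ a) i j  ≡⟨ cong (λ c → mono c (m ∸ a) i j) (m∸[m∸n]≡n (<⇒≤ a<m)) ⟩
  mono a (m ∸ a) i j              ∎
  where open ≡-Reasoning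

φ-∈-DU*-∷ : ∀ n → a ∷ m ∷ r ∈ DU* n → φ (a ∷ m ∷ r) ∈ DU* n
φ-∈-DU*-∷ {a = a} {m = m} {r = r} n π∈
  with π↭ , up ← ∈-DU*⁻ n π∈ | a∈@(0<a , _) , a<m , m≤n ← DU*-head n π∈ =
  ∈-DU*⁺ n (↭-trans (map⁺ σ π↭) (map-slide-range a∈ b∈)) (Equivalence.from T-∧ (ascent , descents))
  where
  σ : ℕ → ℕ
  σ = slide a (m ∸ a)
  b∈ : InRange n (m ∸ a)
  b∈ = m<n⇒0<n∸m a<m , ≤-trans (m∸n≤m m a) m≤n
  ascent : T (σ a <ᵇ σ m)
  ascent = subst₂ (λ u v → T (u <ᵇ v)) (sym (slide-source a (m ∸ a))) (sym (slide-fixes-second 0<a a<m))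
                  (<⇒<ᵇ (m∸n<m 0<a a<m))
  a∉ : All (a ≢_) (m ∷ r)
  a∉ with a∉ ∷ _ ← Unique-resp-↭ (↭-sym π↭) (range-unique n) = a∉
  descents : T (isDown (map σ (m ∷ r)))
  descents = subst T (sym (proj₁ (map-preserves-alternation (slide-monotone a (m ∸ a)) a∉)))
                     (proj₂ (Equivalence.to T-∧ up))

φ-∈-DU* : ∀ n {π} → π ∈ DU* n → φ π ∈ DU* n
φ-∈-DU* n {[]} π∈ = π∈
φ-∈-DU* n {_ ∷ []} π∈ = π∈
φ-∈-DU* n {_ ∷ _ ∷ _} π∈ = φ-∈-DU*-∷ n π∈

φ-involutive : ∀ n {π} → π ∈ DU* n → φ (φ π) ≡ π
φ-involutive n {[]} _ = refl
φ-involutive n {_ ∷ []} _ = refl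
φ-involutive n {_ ∷ _ ∷ _} π∈ with (0<a , _) , a<m , _ ← DU*-head n π∈ = φ-involutive-∷ 0<a a<m

termL∘φ : ∀ n {π} → π ∈ DU* n → termL (φ π) ≈P termR π
termL∘φ n {[]} _ i j = refl
termL∘φ n {_ ∷ []} _ i j = refl
termL∘φ n {_ ∷ _ ∷ r} π∈ with (0<a , _) , a<m , _ ← DU*-head n π∈ = termL∘φ-∷ {r = r} 0<a a<m

map-φ-DU* : ∀ n → map φ (DU* n) ↭ DU* n
map-φ-DU* n = map-bijectionOn-↭ φ φ (DU*-unique n) (φ-∈-DU* n) (φ-∈-DU* n) (φ-involutive n) (φ-involutive n)

corollary2 : (n : ℕ) → 2 ≤ n → ΣP (DU* n) termL ≈P ΣP (DU* n) termR
corollary2 n _ i j = begin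
  ΣP (DU* n) termL i j         ≡⟨ ΣP-↭ termL (↭-sym (map-φ-DU* n)) i j ⟩
  ΣP (map φ (DU* n)) termL i j ≡⟨ ΣP-map φ termL (DU* n) i j ⟩
  ΣP (DU* n) (termL ∘ φ) i j   ≡⟨ ΣP-cong (termL∘φ n) i j ⟩
  ΣP (DU* n) termR i j         ∎
  where open ≡-Reasoning
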